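{- For (nonempty) graphs $G$ and $H$, $\Gamma_{\rho}(G\vee H)=|V(G)|+|V(H)|-\min\{i(G),i(H)\}+1$. In particular, for $s,t\ge1$, $p,r\ge4$ and $n\ge2$: $\Gamma_{\rho}(K_{s,t})=s+t-\min\{s,t\}+1$; $\Gamma_{\rho}(G\vee K_1)=|V(G)|+1$; $\Gamma_{\rho}(K_s\vee\overline{K}_n)=s+n$; $\Gamma_{\rho}(P_p\vee P_r)=\Gamma_{\rho}(P_p\vee C_r)=\Gamma_{\rho}(C_p\vee C_r)=p+r-\min\{\lceil p/3\rceil,\lceil r/3\rceil\}+1$.
   Context: The join $G\vee H$ has vertex set $V(G)\cup V(H)$ (disjoint) and edge set $E(G)\cup E(H)\cup\{gh:g\in V(G),h\in V(H)\}$. $K_n$, $P_n$, $C_n$ are the complete graph, path and cycle on $n$ vertices, $\overline{K}_n$ the edgeless graph on $n$ vertices, $K_{s,t}$ the complete bipartite graph. $i(G)$ is the minimum cardinality of a maximal independent set of $G$. $d(u,v)$ is graph distance. A packing coloring $c:V\to\{1,\dots,k\}$ satisfies: $c(u)=c(v)=i$, $u\ne v$, implies $d(u,v)>i$. The Grundy packing chromatic number $\Gamma_{\rho}(G)$ is the maximum number of colors $k$ in a packing coloring $c:V(G)\to\{1,\dots,k\}$ using all $k$ colors in which every vertex $v$ with $c(v)=i$ has, for every $j\in\{1,\dots,i-1\}$, a vertex $u$ with $c(u)=j$ and $d(u,v)\le j$ (equivalently, the maximum number of colors produced by the greedy procedure that processes vertices in some order and assigns each vertex the smallest color $i$ with no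 already-colored vertex of color $i$ at distance at most $i$). -}

module Defs where

open import Data.Bool using (Bool; true; false; not; _∧_; _∨_; T)
open import Data.Nat using (ℕ; zero; suc; _+_; _∸_; _≤_; _<_; _/_; ∣_-_∣; _≡ᵇ_; _<ᵇ_)
open import Data.Nat.Properties using (∣-∣-comm; ∣n-n∣≡0)
open import Data.Fin using (Fin; toℕ; splitAt; _≟_)
open import Data.Fin.Subset using (Subset; _∈_; _∉_; ∣_∣)
open import Data.Sum using (_⊎_; inj₁; inj₂)
open import Data.Product using (Σ; _×_; _,_; ∃)
open import Relation.Nullary using (¬_)
open import Relation.Nullary.Decidable using (⌊_⌋)
open import Relation.Binary.PropositionalEquality using (_≡_; _≢_; refl; cong)

record Graph (n : ℕ) : Set where
  field
    adj    : Fin n → Fin n → Bool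
    sym    : ∀ u v → adj u v ≡ adj v u
    irrefl : ∀ v → adj v v ≡ false
open Graph public

-- Reach G k u v : d(u,v) ≤ k  (a walk of length at most k from u to v)
data Reach {n : ℕ} (G : Graph n) : ℕ → Fin n → Fin n → Set where
  here : ∀ {k v} → Reach G k v v
  step : ∀ {k u w v} → adj G u w ≡ true → Reach G k w v → Reach G (suc k) u v

IsPackingColoring : ∀ {n} → Graph n → ℕ → (Fin n → ℕ) → Set
IsPackingColoring {n} G k c =
  (∀ v → 1 ≤ c v × c v ≤ k) ×
  (∀ i → 1 ≤ i → i ≤ k → ∃ λ v → c v ≡ i) ×
  (∀ u v → u ≢ v → c u ≡ c v → ¬ Reach G (c u) u v)

IsGrundyPackingColoring : ∀ {n} → Graph n → ℕ → (Fin n → ℕ) → Set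
IsGrundyPackingColoring {n} G k c =
  IsPackingColoring G k c ×
  (∀ v j → 1 ≤ j → j < c v → ∃ λ u → c u ≡ j × Reach G j v u)

GrundyPackingNumber : ∀ {n} → Graph n → ℕ → Set
GrundyPackingNumber {n} G k =
  (∃ λ c → IsGrundyPackingColoring G k c) ×
  (∀ k' (c : Fin n → ℕ) → IsGrundyPackingColoring G k' c → k' ≤ k)

IsIndependent : ∀ {n} → Graph n → Subset n → Set
IsIndependent G S = ∀ u v → u ∈ S → v ∈ S → adj G u v ≡ false

IsMaximalIndependent : ∀ {n} → Graph n → Subset n → Set
IsMaximalIndependent G S =
  IsIndependent G S × (∀ v → v ∉ S → ∃ λ u → u ∈ S × adj G u v ≡ true)

IndepDominationNumber : ∀ {n} → Graph n → ℕ → Set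
IndepDominationNumber {n} G m =
  (∃ λ S → IsMaximalIndependent G S × ∣ S ∣ ≡ m) ×
  (∀ S → IsMaximalIndependent G S → m ≤ ∣ S ∣)

module _ {m n : ℕ} where
  sumAdj : (Fin m → Fin m → Bool) → (Fin n → Fin n → Bool) →
           Fin m ⊎ Fin n → Fin m ⊎ Fin n → Bool
  sumAdj a b (inj₁ x) (inj₁ y) = a x y
  sumAdj a b (inj₂ x) (inj₂ y) = b x y
  sumAdj a b (inj₁ x) (inj₂ y) = true
  sumAdj a b (inj₂ x) (inj₁ y) = true

  sumAdj-sym : ∀ (G : Graph m) (H : Graph n) x y →
    sumAdj (adj G) (adj H) x y ≡ sumAdj (adj G) (adj H) y x
  sumAdj-sym G H (inj₁ x) (inj₁ y) = sym G x y
  sumAdj-sym G H (inj₂ x) (inj₂ y) = sym H x y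
  sumAdj-sym G H (inj₁ x) (inj₂ y) = refl
  sumAdj-sym G H (inj₂ x) (inj₁ y) = refl

  sumAdj-irr : ∀ (G : Graph m) (H : Graph n) x → sumAdj (adj G) (adj H) x x ≡ false
  sumAdj-irr G H (inj₁ x) = irrefl G x
  sumAdj-irr G H (inj₂ x) = irrefl H x

-- G ∨ H : vertices of G are 0..m-1, vertices of H are m..m+n-1
_∨G_ : ∀ {m n} → Graph m → Graph n → Graph (m + n)
_∨G_ {m} {n} G H = record
  { adj    = λ u v → sumAdj (adj G) (adj H) (splitAt m u) (splitAt m v)
  ; sym    = λ u v → sumAdj-sym G H (splitAt m u) (splitAt m v)
  ; irrefl = λ v → sumAdj-irr G H (splitAt m v)
  }

K : (n : ℕ) → Graph n
K n = record
  { adj    = λ u v → not ⌊ u ≟ v ⌋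
  ; sym    = λ u v → cong not (dec-sym u v)
  ; irrefl = λ v → cong not (dec-refl v)
  }
  where
  dec-refl : ∀ v → ⌊ v ≟ v ⌋ ≡ true
  dec-refl v with v ≟ v
  ... | Relation.Nullary.yes _ = refl
  ... | Relation.Nullary.no ¬p = Data.Empty.⊥-elim (¬p refl)
    where import Data.Empty
  dec-sym : ∀ u v → ⌊ u ≟ v ⌋ ≡ ⌊ v ≟ u ⌋
  dec-sym u v with u ≟ v | v ≟ u
  ... | Relation.Nullary.yes _ | Relation.Nullary.yes _ = refl
  ... | Relation.Nullary.no _  | Relation.Nullary.no _  = refl
  ... | Relation.Nullary.yes p | Relation.Nullary.no ¬q = Data.Empty.⊥-elim (¬q (Relation.Binary.PropositionalEquality.sym p))
    where import Data.Empty
  ... | Relation.Nullary.no ¬p | Relation.Nullary.yes q = Data.Empty.⊥-elim (¬p (Relation.Binary.PropositionalEquality.sym q))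
    where import Data.Empty

Kbar : (n : ℕ) → Graph n
Kbar n = record { adj = λ _ _ → false ; sym = λ _ _ → refl ; irrefl = λ _ → refl }

Kbip : (s t : ℕ) → Graph (s + t)
Kbip s t = Kbar s ∨G Kbar t

vdist : ∀ {n} → Fin n → Fin n → ℕ
vdist u v = ∣ toℕ u - toℕ v ∣

P : (n : ℕ) → Graph n
P n = record
  { adj    = λ u v → vdist u v ≡ᵇ 1
  ; sym    = λ u v → cong (_≡ᵇ 1) (∣-∣-comm (toℕ u) (toℕ v))
  ; irrefl = λ v → cong (_≡ᵇ 1) (∣n-n∣≡0 (toℕ v))
  }

-- cycle C_n (n ≥ 3) : the path plus the edge {0, n-1}
C : (n : ℕ) → Graph n
C n = record
  { adj    = λ u v → (vdist u v ≡ᵇ 1) ∨ ((1 <ᵇ vdist u v) ∧ (vdist u v ≡ᵇ (n ∸ 1)))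
  ; sym    = λ u v → cong (λ d → (d ≡ᵇ 1) ∨ ((1 <ᵇ d) ∧ (d ≡ᵇ (n ∸ 1)))) (∣-∣-comm (toℕ u) (toℕ v))
  ; irrefl = λ v → cong (λ d → (d ≡ᵇ 1) ∨ ((1 <ᵇ d) ∧ (d ≡ᵇ (n ∸ 1)))) (∣n-n∣≡0 (toℕ v))
  }

ceil3 : ℕ → ℕ
ceil3 p = (p + 2) / 3

{-# OPTIONS --safe #-}
-- Colour class 1 of a Grundy packing colouring is a maximal independent set (two vertices
-- of colour 1 are not adjacent, and every other vertex sees colour 1 within distance 1),
-- and the colours 2, …, k need distinct vertices outside it; hence Γ_ρ(G) ≤ |V| − i(G) + 1
-- for every graph.  If G has diameter at most 2 this is attained: colour a minimum maximal
-- independent set S with 1 and the remaining vertices with distinct colours 2, 3, …; each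
-- of them has a neighbour in S and sees every other vertex within distance 2.  A join of
-- two nonempty graphs has diameter 2, and its maximal independent sets are exactly those
-- of G and those of H, so i(G ∨ H) = min(i(G), i(H)).  For paths and cycles i = ⌈p/3⌉:
-- a vertex dominates at most three cyclically consecutive vertices, and the vertices
-- 1, 4, 7, … (together with the last one when p ≡ 1 mod 3) form a maximal independent set.
module Submission where

open import Defs
import Data.Nat.Properties as ℕₚ
open import Algebra.Properties.CommutativeMonoid.Sum ℕₚ.+-0-commutativeMonoid
  using (sum; sum-init-last; sum-cong-≗; ∑-distrib-+)
open import Data.Bool using (Bool; true; false; not; if_then_else_)
open import Data.Bool.Properties using (¬-not; T-≡; T-∨; T-∧)
open import Data.Fin using (Fin; zero; suc; toℕ; fromℕ; fromℕ<; inject₁; _↑ˡ_; _↑ʳ_; splitAt; _≟_)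
import Data.Fin.Properties as Finₚ
open import Data.Fin.Subset using (Subset; inside; outside; _∈_; _∉_; ∣_∣; ∁; ⊥; ⊤; ⁅_⁆; Nonempty)
open import Data.Fin.Subset.Properties
  using (_∈?_; x∈p⇒x∉∁p; x∉p⇒x∈∁p; x∉∁p⇒x∈p; ∣∁p∣≡n∸∣p∣; ∉⊥; ∈⊤; ∣⊥∣≡0; ∣⊤∣≡n;
         x∈⁅x⁆; x∈⁅y⁆⇒x≡y; x∉⁅y⁆⇒x≢y; ∣⁅x⁆∣≡1; p⊆q⇒∣p∣≤∣q∣; nonempty?; Empty-unique)
open import Data.Nat using (ℕ; zero; suc; _+_; _*_; _∸_; _≤_; _<_; _⊓_; _≡ᵇ_; _<?_; z≤n; s≤s; ∣_-_∣)
open import Data.Nat.Properties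
  using (≤-refl; ≤-trans; ≤-reflexive; ≤-total; <⇒≤; ≤∧≢⇒<; +-comm; +-assoc; +-identityʳ;
         +-mono-≤; +-monoʳ-≤; +-monoʳ-<; m≤m+n; m≤n+m; n<1+n; *-comm; ∸-monoʳ-≤;
         m≤n⇒m⊓n≡m; m≥n⇒m⊓n≡n; ∣-∣-comm; ∣m-n∣≤m⊔n; ⊔-lub; ≡ᵇ⇒≡; ≡⇒≡ᵇ; module ≤-Reasoning)
open import Data.Nat.DivMod using (m<n*o⇒m/o<n; m/n≡1+[m∸n]/n)
open import Data.Product using (∃; ∃₂; _×_; _,_; proj₁; proj₂)
open import Data.Sum using (_⊎_; inj₁; inj₂; map; map₂)
open import Data.Vec using ([]; _∷_; _++_; lookup; tabulate; here; there)
import Data.Vec as Vec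
open import Data.Vec.Properties using ([]=⇒lookup; lookup⇒[]=; lookup∘tabulate)
open import Function using (_∘_; case_of_; Equivalence)
open import Relation.Binary.PropositionalEquality as ≡
  using (_≡_; _≢_; refl; trans; cong; cong₂; subst; module ≡-Reasoning)
open import Relation.Nullary using (¬_; yes; no; contradiction)
open import Relation.Nullary.Decidable using (dec-false; isYes≗does)

private
  variable
    m n : ℕ

-- Subsets and finite sums

index : ∀ {p : Subset n} {x} → x ∈ p → Fin ∣ p ∣
index {p = inside ∷ _}  here        = zero
index {p = inside ∷ _}  (there x∈p) = suc (index x∈p)
index {p = outside ∷ _} (there x∈p) = index x∈p

index-irrelevant : ∀ {p : Subset n} {x} (a b : x ∈ p) → index a ≡ index b
index-irrelevant {p = inside ∷ _}  here      here      = refl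
index-irrelevant {p = inside ∷ _}  (there a) (there b) = cong suc (index-irrelevant a b)
index-irrelevant {p = outside ∷ _} (there a) (there b) = index-irrelevant a b

index-injective : ∀ {p : Subset n} {x y} (a : x ∈ p) (b : y ∈ p) → index a ≡ index b → x ≡ y
index-injective {p = inside ∷ _}  here      here      _  = refl
index-injective {p = inside ∷ _}  (there a) (there b) eq = cong suc (index-injective a b (Finₚ.suc-injective eq))
index-injective {p = outside ∷ _} (there a) (there b) eq = cong suc (index-injective a b eq)

index-surjective : ∀ (p : Subset n) (i : Fin ∣ p ∣) → ∃₂ λ x (x∈p : x ∈ p) → index x∈p ≡ i
index-surjective (inside ∷ p) zero = zero , here , refl
index-surjective (inside ∷ p) (suc i) =
  let x , x∈p , eq = index-surjective p i in suc x , there x∈p , cong suc eq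
index-surjective (outside ∷ p) i =
  let x , x∈p , eq = index-surjective p i in suc x , there x∈p , eq

x∈p⇒1≤∣p∣ : ∀ {p : Subset n} {x} → x ∈ p → 1 ≤ ∣ p ∣
x∈p⇒1≤∣p∣ x∈p = ≤-trans (s≤s z≤n) (Finₚ.toℕ<n (index x∈p))

∈-tabulate⁺ : ∀ {f : Fin n → Bool} {x} → f x ≡ true → x ∈ tabulate f
∈-tabulate⁺ {f = f} {x = x} fx = lookup⇒[]= x (tabulate f) (trans (lookup∘tabulate f x) fx)

∈-tabulate⁻ : ∀ {f : Fin n → Bool} {x} → x ∈ tabulate f → f x ≡ true
∈-tabulate⁻ {f = f} {x = x} x∈ = trans (≡.sym (lookup∘tabulate f x)) ([]=⇒lookup x∈)

indicator : Subset n → Fin n → ℕ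
indicator p x = if lookup p x then 1 else 0

indicator-∈ : ∀ {p : Subset n} {x} → x ∈ p → indicator p x ≡ 1
indicator-∈ x∈p rewrite []=⇒lookup x∈p = refl

∣p∣≡∑indicator : ∀ {n} (p : Subset n) → ∣ p ∣ ≡ sum (indicator p)
∣p∣≡∑indicator []            = refl
∣p∣≡∑indicator (inside ∷ p)  = cong suc (∣p∣≡∑indicator p)
∣p∣≡∑indicator (outside ∷ p) = ∣p∣≡∑indicator p

∈-++⁺ˡ : ∀ {p : Subset m} {q : Subset n} {x} → x ∈ p → x ↑ˡ n ∈ p ++ q
∈-++⁺ˡ here        = here
∈-++⁺ˡ (there x∈p) = there (∈-++⁺ˡ x∈p)

∈-++⁻ˡ : ∀ {p : Subset m} {q : Subset n} x → x ↑ˡ n ∈ p ++ q → x ∈ p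
∈-++⁻ˡ {p = _ ∷ _} zero    here      = here
∈-++⁻ˡ {p = _ ∷ _} (suc x) (there h) = there (∈-++⁻ˡ x h)

∈-++⁺ʳ : ∀ {m n} (p : Subset m) {q : Subset n} {y} → y ∈ q → m ↑ʳ y ∈ p ++ q
∈-++⁺ʳ []      y∈q = y∈q
∈-++⁺ʳ (_ ∷ p) y∈q = there (∈-++⁺ʳ p y∈q)

∈-++⁻ʳ : ∀ {m n} (p : Subset m) {q : Subset n} {y} → m ↑ʳ y ∈ p ++ q → y ∈ q
∈-++⁻ʳ []      h         = h
∈-++⁻ʳ (_ ∷ p) (there h) = ∈-++⁻ʳ p h

∣p++q∣≡∣p∣+∣q∣ : ∀ {m n} (p : Subset m) (q : Subset n) → ∣ p ++ q ∣ ≡ ∣ p ∣ + ∣ q ∣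
∣p++q∣≡∣p∣+∣q∣ []            q = refl
∣p++q∣≡∣p∣+∣q∣ (inside ∷ p)  q = cong suc (∣p++q∣≡∣p∣+∣q∣ p q)
∣p++q∣≡∣p∣+∣q∣ (outside ∷ p) q = ∣p++q∣≡∣p∣+∣q∣ p q

∣p++⊥∣≡∣p∣ : ∀ {m n} (p : Subset m) → ∣ p ++ ⊥ {n} ∣ ≡ ∣ p ∣
∣p++⊥∣≡∣p∣ {n = n} p =
  trans (∣p++q∣≡∣p∣+∣q∣ p ⊥) (trans (cong (∣ p ∣ +_) (∣⊥∣≡0 n)) (+-identityʳ _))

∣⊥++p∣≡∣p∣ : ∀ {m n} (p : Subset n) → ∣ ⊥ {m} ++ p ∣ ≡ ∣ p ∣
∣⊥++p∣≡∣p∣ {m} p = trans (∣p++q∣≡∣p∣+∣q∣ (⊥ {m}) p) (cong (_+ ∣ p ∣) (∣⊥∣≡0 m))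

n≤sum : ∀ {n} (f : Fin n → ℕ) → (∀ i → 1 ≤ f i) → n ≤ sum f
n≤sum {zero}  f _   = z≤n
n≤sum {suc n} f pos = +-mono-≤ (pos zero) (n≤sum (f ∘ suc) (pos ∘ suc))

cyclicPred : ∀ {q} → Fin (suc q) → Fin (suc q)
cyclicPred {q} zero = fromℕ q
cyclicPred (suc i)  = inject₁ i

cyclicSuc : ∀ {q} → Fin (suc q) → Fin (suc q)
cyclicSuc {q} i with toℕ i <? q
... | yes i<q = suc (fromℕ< i<q)
... | no _    = zero

toℕ-cyclicPred : ∀ {q} {i : Fin (suc q)} {j} → toℕ i ≡ suc j → toℕ (cyclicPred i) ≡ j
toℕ-cyclicPred {i = suc i} eq = trans (Finₚ.toℕ-inject₁ i) (ℕₚ.suc-injective eq)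

toℕ-cyclicPred-zero : ∀ {q} → toℕ (cyclicPred {q} zero) ≡ q
toℕ-cyclicPred-zero {q} = Finₚ.toℕ-fromℕ q

toℕ-cyclicSuc : ∀ {q} {i : Fin (suc q)} → toℕ i < q → toℕ (cyclicSuc i) ≡ suc (toℕ i)
toℕ-cyclicSuc {q} {i} i<q with toℕ i <? q
... | yes _   = cong suc (Finₚ.toℕ-fromℕ< _)
... | no i≮q  = contradiction i<q i≮q

cyclicSuc-last : ∀ {q} {i : Fin (suc q)} → toℕ i ≡ q → cyclicSuc i ≡ zero
cyclicSuc-last {q} {i} i≡q with toℕ i <? q
... | yes i<q = contradiction (subst (_< q) i≡q i<q) (ℕₚ.<-irrefl refl)
... | no _    = refl

cyclicSuc-cyclicPred : ∀ {q} (i : Fin (suc q)) → cyclicSuc (cyclicPred i) ≡ i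
cyclicSuc-cyclicPred zero    = cyclicSuc-last toℕ-cyclicPred-zero
cyclicSuc-cyclicPred (suc i) = Finₚ.toℕ-injective (begin
  toℕ (cyclicSuc (inject₁ i))  ≡⟨ toℕ-cyclicSuc i<q ⟩
  suc (toℕ (inject₁ i))        ≡⟨ cong suc (Finₚ.toℕ-inject₁ i) ⟩
  suc (toℕ i)                  ∎)
  where
  open ≡-Reasoning
  i<q = subst (_< _) (≡.sym (Finₚ.toℕ-inject₁ i)) (Finₚ.toℕ<n i)

∑-cyclicPred : ∀ {q} (f : Fin (suc q) → ℕ) → sum (f ∘ cyclicPred) ≡ sum f
∑-cyclicPred {q} f = trans (+-comm (f (fromℕ q)) _) (≡.sym (sum-init-last f))

∑-cyclicSuc : ∀ {q} (f : Fin (suc q) → ℕ) → sum (f ∘ cyclicSuc) ≡ sum f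
∑-cyclicSuc f = trans (≡.sym (∑-cyclicPred (f ∘ cyclicSuc))) (sum-cong-≗ (cong f ∘ cyclicSuc-cyclicPred))

-- Distances and dominating sets

module _ {G : Graph n} where

  Reach-mono : ∀ {k k′ u v} → k ≤ k′ → Reach G k u v → Reach G k′ u v
  Reach-mono _           here       = here
  Reach-mono (s≤s k≤k′) (step a r) = step a (Reach-mono k≤k′ r)

  Reach-1⇒ : ∀ {u v} → Reach G 1 u v → u ≡ v ⊎ adj G u v ≡ true
  Reach-1⇒ here          = inj₁ refl
  Reach-1⇒ (step a here) = inj₂ a

adj⇒≢ : ∀ (G : Graph n) {u v} → adj G u v ≡ true → u ≢ v
adj⇒≢ G {u} uv refl with () ← trans (≡.sym uv) (irrefl G u)

Diameter≤2 : Graph n → Set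
Diameter≤2 G = ∀ u v → Reach G 2 u v

IsDominating : Graph n → Subset n → Set
IsDominating G S = ∀ v → v ∉ S → ∃ λ u → u ∈ S × adj G u v ≡ true

mis-nonempty : ∀ {G : Graph (suc n)} {S} → IsMaximalIndependent G S → Nonempty S
mis-nonempty {S = S} (_ , dominating) with zero ∈? S
... | yes 0∈S = zero , 0∈S
... | no  0∉S = let u , u∈S , _ = dominating zero 0∉S in u , u∈S

1≤∣mis∣ : ∀ {G : Graph (suc n)} {S} → IsMaximalIndependent G S → 1 ≤ ∣ S ∣
1≤∣mis∣ {G = G} mis = x∈p⇒1≤∣p∣ (proj₂ (mis-nonempty {G = G} mis))

-- Grundy packing colourings

colourClass : (Fin n → ℕ) → ℕ → Subset n
colourClass c i = tabulate (λ v → c v ≡ᵇ i)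

module _ (c : Fin n → ℕ) {i : ℕ} {v : Fin n} where

  ∈-colourClass⁺ : c v ≡ i → v ∈ colourClass c i
  ∈-colourClass⁺ cv≡i = ∈-tabulate⁺ (Equivalence.to T-≡ (≡⇒≡ᵇ (c v) i cv≡i))

  ∈-colourClass⁻ : v ∈ colourClass c i → c v ≡ i
  ∈-colourClass⁻ v∈ = ≡ᵇ⇒≡ (c v) i (Equivalence.from T-≡ (∈-tabulate⁻ v∈))

module _ {G : Graph n} {k : ℕ} {c : Fin n → ℕ} where

  colourClass₁-mis : IsGrundyPackingColoring G k c → IsMaximalIndependent G (colourClass c 1)
  colourClass₁-mis ((range , _ , packing) , grundy) = independent , dominating
    where
    independent : IsIndependent G (colourClass c 1)
    independent u v u∈ v∈ = ¬-not λ uv →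
      let cu≡1 = ∈-colourClass⁻ c u∈ in
      packing u v (adj⇒≢ G uv) (trans cu≡1 (≡.sym (∈-colourClass⁻ c v∈)))
              (subst (λ i → Reach G i u v) (≡.sym cu≡1) (step uv here))
    dominating : IsDominating G (colourClass c 1)
    dominating v v∉ with grundy v 1 ≤-refl (≤∧≢⇒< (proj₁ (range v)) (v∉ ∘ ∈-colourClass⁺ c ∘ ≡.sym))
    ... | u , cu≡1 , r with Reach-1⇒ r
    ...   | inj₁ refl = contradiction (∈-colourClass⁺ c cu≡1) v∉
    ...   | inj₂ vu   = u , ∈-colourClass⁺ c cu≡1 , trans (sym G u v) vu

colours≤1+∣∁colourClass₁∣ : ∀ {k} {c : Fin n → ℕ} → (∀ i → 1 ≤ i → i ≤ k → ∃ λ v → c v ≡ i) →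
                            k ≤ suc ∣ ∁ (colourClass c 1) ∣
colours≤1+∣∁colourClass₁∣ {k = zero}  _    = z≤n
colours≤1+∣∁colourClass₁∣ {k = suc k} {c} surj = s≤s (Finₚ.injective⇒≤ index∘vertex-injective)
  where
  vertex : (i : Fin k) → ∃ λ v → c v ≡ 2 + toℕ i
  vertex i = surj (2 + toℕ i) (s≤s z≤n) (s≤s (Finₚ.toℕ<n i))
  vertex-∉ : ∀ i → proj₁ (vertex i) ∈ ∁ (colourClass c 1)
  vertex-∉ i = x∉p⇒x∈∁p λ v∈ → case trans (≡.sym (proj₂ (vertex i))) (∈-colourClass⁻ c v∈) of λ ()
  index∘vertex-injective : ∀ {i j} → index (vertex-∉ i) ≡ index (vertex-∉ j) → i ≡ j
  index∘vertex-injective {i} {j} eq = Finₚ.toℕ-injective (ℕₚ.suc-injective (ℕₚ.suc-injective (begin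
    2 + toℕ i            ≡⟨ ≡.sym (proj₂ (vertex i)) ⟩
    c (proj₁ (vertex i)) ≡⟨ cong c (index-injective (vertex-∉ i) (vertex-∉ j) eq) ⟩
    c (proj₁ (vertex j)) ≡⟨ proj₂ (vertex j) ⟩
    2 + toℕ j            ∎)))
    where open ≡-Reasoning

grundyPacking-≤ : ∀ {G : Graph n} {a k c} → IndepDominationNumber G a →
                  IsGrundyPackingColoring G k c → k ≤ n ∸ a + 1
grundyPacking-≤ {n} {a = a} {k} {c} (_ , minimal) grundy@((_ , surj , _) , _) = begin
  k                    ≤⟨ colours≤1+∣∁colourClass₁∣ surj ⟩
  suc ∣ ∁ S ∣          ≡⟨ cong suc (∣∁p∣≡n∸∣p∣ S) ⟩
  suc (n ∸ ∣ S ∣)      ≤⟨ s≤s (∸-monoʳ-≤ n (minimal S (colourClass₁-mis grundy))) ⟩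
  suc (n ∸ a)          ≡⟨ +-comm 1 (n ∸ a) ⟩
  n ∸ a + 1            ∎
  where
  open ≤-Reasoning
  S = colourClass c 1

misColouring : Subset n → Fin n → ℕ
misColouring S v with v ∈? ∁ S
... | yes v∈∁S = 2 + toℕ (index v∈∁S)
... | no _     = 1

module _ {S : Subset n} where

  misColouring-∈ : ∀ {v} → v ∈ S → misColouring S v ≡ 1
  misColouring-∈ {v} v∈S with v ∈? ∁ S
  ... | yes v∈∁S = contradiction v∈∁S (x∈p⇒x∉∁p v∈S)
  ... | no _     = refl

  misColouring-∁ : ∀ {v} (v∈∁S : v ∈ ∁ S) → misColouring S v ≡ 2 + toℕ (index v∈∁S)
  misColouring-∁ {v} v∈∁S with v ∈? ∁ S
  ... | yes h   = cong (λ i → 2 + toℕ i) (index-irrelevant h v∈∁S)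
  ... | no v∉∁S = contradiction v∈∁S v∉∁S

  misColouring-range : ∀ v → 1 ≤ misColouring S v × misColouring S v ≤ suc ∣ ∁ S ∣
  misColouring-range v with v ∈? ∁ S
  ... | yes v∈∁S = s≤s z≤n , s≤s (Finₚ.toℕ<n (index v∈∁S))
  ... | no _     = s≤s z≤n , s≤s z≤n

  misColouring-surjective : Nonempty S → ∀ i → 1 ≤ i → i ≤ suc ∣ ∁ S ∣ → ∃ λ v → misColouring S v ≡ i
  misColouring-surjective (s , s∈S) 1 _ _ = s , misColouring-∈ s∈S
  misColouring-surjective _ (suc (suc t)) _ (s≤s 1+t≤∣∁S∣) =
    let v , v∈∁S , eq = index-surjective (∁ S) (fromℕ< 1+t≤∣∁S∣) in
    v , trans (misColouring-∁ v∈∁S) (cong (2 +_) (trans (cong toℕ eq) (Finₚ.toℕ-fromℕ< 1+t≤∣∁S∣)))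

  misColouring-packing : ∀ {G : Graph n} → IsIndependent G S →
                         ∀ u v → u ≢ v → misColouring S u ≡ misColouring S v → ¬ Reach G (misColouring S u) u v
  misColouring-packing independent u v u≢v cu≡cv with u ∈? ∁ S | v ∈? ∁ S
  ... | yes u∈∁S | yes v∈∁S = λ _ → u≢v (index-injective u∈∁S v∈∁S
                                 (Finₚ.toℕ-injective (ℕₚ.suc-injective (ℕₚ.suc-injective cu≡cv))))
  ... | yes _    | no _     = case cu≡cv of λ ()
  ... | no _     | yes _    = case cu≡cv of λ ()
  ... | no u∉∁S  | no v∉∁S  = λ r → case Reach-1⇒ r of λ where
    (inj₁ u≡v) → u≢v u≡v
    (inj₂ uv)  → case trans (≡.sym uv) (independent u v (x∉∁p⇒x∈p u∉∁S) (x∉∁p⇒x∈p v∉∁S)) of λ ()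

  misColouring-grundy : ∀ {G : Graph n} → Diameter≤2 G → IsMaximalIndependent G S → Nonempty S →
                        IsGrundyPackingColoring G (suc ∣ ∁ S ∣) (misColouring S)
  misColouring-grundy {G} diameter≤2 (independent , dominating) nonempty =
    (misColouring-range , misColouring-surjective nonempty , misColouring-packing independent) , grundy
    where
    grundy : ∀ v j → 1 ≤ j → j < misColouring S v → ∃ λ u → misColouring S u ≡ j × Reach G j v u
    grundy v 1 _ 1<cv with dominating v (λ v∈S → ℕₚ.<-irrefl (≡.sym (misColouring-∈ v∈S)) 1<cv)
    ... | u , u∈S , uv = u , misColouring-∈ u∈S , step (trans (sym G v u) uv) here
    grundy v (suc (suc t)) _ j<cv =
      let u , cu≡j = misColouring-surjective nonempty (suc (suc t)) (s≤s z≤n)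
                       (≤-trans (<⇒≤ j<cv) (proj₂ (misColouring-range v))) in
      u , cu≡j , Reach-mono (s≤s (s≤s z≤n)) (diameter≤2 v u)

grundyPackingNumber-diameter≤2 : ∀ {G : Graph (suc n)} {a} → Diameter≤2 G →
  IndepDominationNumber G a → GrundyPackingNumber G (suc n ∸ a + 1)
grundyPackingNumber-diameter≤2 {n} {G} {a} diameter≤2 i@((S , mis , ∣S∣≡a) , _) =
  (misColouring S , subst (λ k → IsGrundyPackingColoring G k (misColouring S)) colours≡
                          (misColouring-grundy diameter≤2 mis (mis-nonempty {G = G} mis))) ,
  λ _ _ → grundyPacking-≤ i
  where
  colours≡ : suc ∣ ∁ S ∣ ≡ suc n ∸ a + 1
  colours≡ = trans (cong suc (trans (∣∁p∣≡n∸∣p∣ S) (cong (suc n ∸_) ∣S∣≡a))) (+-comm 1 _)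

-- Joins

data JoinView (m n : ℕ) : Fin (m + n) → Set where
  inl : ∀ x → JoinView m n (x ↑ˡ n)
  inr : ∀ y → JoinView m n (m ↑ʳ y)

joinView : ∀ m {n} (u : Fin (m + n)) → JoinView m n u
joinView m u with splitAt m u in eq
... | inj₁ x = subst (JoinView m _) (Finₚ.splitAt⁻¹-↑ˡ eq) (inl x)
... | inj₂ y = subst (JoinView m _) (Finₚ.splitAt⁻¹-↑ʳ eq) (inr y)

module _ (G : Graph m) (H : Graph n) where

  ∨-adjˡˡ : ∀ x y → adj (G ∨G H) (x ↑ˡ n) (y ↑ˡ n) ≡ adj G x y
  ∨-adjˡˡ x y rewrite Finₚ.splitAt-↑ˡ m x n | Finₚ.splitAt-↑ˡ m y n = refl

  ∨-adjʳʳ : ∀ x y → adj (G ∨G H) (m ↑ʳ x) (m ↑ʳ y) ≡ adj H x y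
  ∨-adjʳʳ x y rewrite Finₚ.splitAt-↑ʳ m n x | Finₚ.splitAt-↑ʳ m n y = refl

  ∨-adjˡʳ : ∀ x y → adj (G ∨G H) (x ↑ˡ n) (m ↑ʳ y) ≡ true
  ∨-adjˡʳ x y rewrite Finₚ.splitAt-↑ˡ m x n | Finₚ.splitAt-↑ʳ m n y = refl

  ∨-adjʳˡ : ∀ x y → adj (G ∨G H) (m ↑ʳ x) (y ↑ˡ n) ≡ true
  ∨-adjʳˡ x y rewrite Finₚ.splitAt-↑ʳ m n x | Finₚ.splitAt-↑ˡ m y n = refl

∨-diameter≤2 : ∀ {m n} (G : Graph (suc m)) (H : Graph (suc n)) → Diameter≤2 (G ∨G H)
∨-diameter≤2 {m} {n} G H u v with joinView (suc m) u | joinView (suc m) v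
... | inl x | inl y = step {w = suc m ↑ʳ zero} (∨-adjˡʳ G H x zero) (step (∨-adjʳˡ G H zero y) here)
... | inl x | inr y = step (∨-adjˡʳ G H x y) here
... | inr x | inl y = step (∨-adjʳˡ G H x y) here
... | inr x | inr y = step {w = zero ↑ˡ suc n} (∨-adjʳˡ G H x zero) (step (∨-adjˡʳ G H zero y) here)

module _ {G : Graph m} {H : Graph n} where

  ∨-mis⁺ˡ : ∀ {S} → IsMaximalIndependent G S → Nonempty S → IsMaximalIndependent (G ∨G H) (S ++ ⊥)
  ∨-mis⁺ˡ {S} (independent , dominating) (s , s∈S) = independent′ , dominating′
    where
    independent′ : IsIndependent (G ∨G H) (S ++ ⊥)
    independent′ u v u∈ v∈ with joinView m u | joinView m v
    ... | inl x | inl y = trans (∨-adjˡˡ G H x y) (independent x y (∈-++⁻ˡ x u∈) (∈-++⁻ˡ y v∈))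
    ... | inl _ | inr y = contradiction (∈-++⁻ʳ S v∈) ∉⊥
    ... | inr x | _     = contradiction (∈-++⁻ʳ S u∈) ∉⊥
    dominating′ : IsDominating (G ∨G H) (S ++ ⊥)
    dominating′ v v∉ with joinView m v
    ... | inl x = let u , u∈S , ux = dominating x (v∉ ∘ ∈-++⁺ˡ) in
                  u ↑ˡ n , ∈-++⁺ˡ u∈S , trans (∨-adjˡˡ G H u x) ux
    ... | inr y = s ↑ˡ n , ∈-++⁺ˡ s∈S , ∨-adjˡʳ G H s y

  ∨-mis⁺ʳ : ∀ {S} → IsMaximalIndependent H S → Nonempty S → IsMaximalIndependent (G ∨G H) (⊥ ++ S)
  ∨-mis⁺ʳ {S} (independent , dominating) (s , s∈S) = independent′ , dominating′
    where
    independent′ : IsIndependent (G ∨G H) (⊥ ++ S)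
    independent′ u v u∈ v∈ with joinView m u | joinView m v
    ... | inr x | inr y = trans (∨-adjʳʳ G H x y) (independent x y (∈-++⁻ʳ ⊥ u∈) (∈-++⁻ʳ ⊥ v∈))
    ... | inr _ | inl y = contradiction (∈-++⁻ˡ y v∈) ∉⊥
    ... | inl x | _     = contradiction (∈-++⁻ˡ x u∈) ∉⊥
    dominating′ : IsDominating (G ∨G H) (⊥ ++ S)
    dominating′ v v∉ with joinView m v
    ... | inr y = let u , u∈S , uy = dominating y (v∉ ∘ ∈-++⁺ʳ ⊥) in
                  m ↑ʳ u , ∈-++⁺ʳ ⊥ u∈S , trans (∨-adjʳʳ G H u y) uy
    ... | inl x = m ↑ʳ s , ∈-++⁺ʳ ⊥ s∈S , ∨-adjʳˡ G H s x

  ∨-mis⁻ˡ : ∀ {S} → IsMaximalIndependent (G ∨G H) (S ++ ⊥) → IsMaximalIndependent G S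
  ∨-mis⁻ˡ {S} (independent , dominating) = independent′ , dominating′
    where
    independent′ : IsIndependent G S
    independent′ x y x∈ y∈ =
      trans (≡.sym (∨-adjˡˡ G H x y)) (independent _ _ (∈-++⁺ˡ x∈) (∈-++⁺ˡ y∈))
    dominating′ : IsDominating G S
    dominating′ x x∉ with dominating (x ↑ˡ n) (x∉ ∘ ∈-++⁻ˡ x)
    ... | u , u∈ , ux with joinView m u
    ...   | inl u′ = u′ , ∈-++⁻ˡ u′ u∈ , trans (≡.sym (∨-adjˡˡ G H u′ x)) ux
    ...   | inr y  = contradiction (∈-++⁻ʳ S u∈) ∉⊥

  ∨-mis⁻ʳ : ∀ {S} → IsMaximalIndependent (G ∨G H) (⊥ ++ S) → IsMaximalIndependent H S
  ∨-mis⁻ʳ {S} (independent , dominating) = independent′ , dominating′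
    where
    independent′ : IsIndependent H S
    independent′ x y x∈ y∈ =
      trans (≡.sym (∨-adjʳʳ G H x y)) (independent _ _ (∈-++⁺ʳ ⊥ x∈) (∈-++⁺ʳ ⊥ y∈))
    dominating′ : IsDominating H S
    dominating′ y y∉ with dominating (m ↑ʳ y) (y∉ ∘ ∈-++⁻ʳ ⊥)
    ... | u , u∈ , uy with joinView m u
    ...   | inr u′ = u′ , ∈-++⁻ʳ ⊥ u∈ , trans (≡.sym (∨-adjʳʳ G H u′ y)) uy
    ...   | inl x  = contradiction (∈-++⁻ˡ x u∈) ∉⊥

  ∨-independent-split : ∀ {S S′} → IsIndependent (G ∨G H) (S ++ S′) → S′ ≡ ⊥ ⊎ S ≡ ⊥
  ∨-independent-split {S} {S′} independent with nonempty? S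
  ... | no  S-empty = inj₂ (Empty-unique S-empty)
  ... | yes (x , x∈S) = inj₁ (Empty-unique λ (y , y∈S′) →
        case trans (≡.sym (∨-adjˡʳ G H x y)) (independent _ _ (∈-++⁺ˡ x∈S) (∈-++⁺ʳ S y∈S′)) of λ ())

  ∨-mis⁻ : ∀ {T} → IsMaximalIndependent (G ∨G H) T →
           (∃ λ S → IsMaximalIndependent G S × ∣ T ∣ ≡ ∣ S ∣) ⊎
           (∃ λ S → IsMaximalIndependent H S × ∣ T ∣ ≡ ∣ S ∣)
  ∨-mis⁻ {T} mis with Vec.splitAt m T
  ... | S , S′ , refl with ∨-independent-split {S} {S′} (proj₁ mis)
  ...   | inj₁ refl = inj₁ (S  , ∨-mis⁻ˡ mis , ∣p++⊥∣≡∣p∣ S)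
  ...   | inj₂ refl = inj₂ (S′ , ∨-mis⁻ʳ mis , ∣⊥++p∣≡∣p∣ {m} S′)

module _ {m n : ℕ} {G : Graph (suc m)} {H : Graph (suc n)} {a : ℕ} where

  ∨-mis-≥ : (∀ S → IsMaximalIndependent G S → a ≤ ∣ S ∣) →
            (∀ S → IsMaximalIndependent H S → a ≤ ∣ S ∣) →
            ∀ T → IsMaximalIndependent (G ∨G H) T → a ≤ ∣ T ∣
  ∨-mis-≥ minimalG minimalH T mis with ∨-mis⁻ {G = G} {H = H} mis
  ... | inj₁ (S , misG , ∣T∣≡∣S∣) = subst (a ≤_) (≡.sym ∣T∣≡∣S∣) (minimalG S misG)
  ... | inj₂ (S , misH , ∣T∣≡∣S∣) = subst (a ≤_) (≡.sym ∣T∣≡∣S∣) (minimalH S misH)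

  indepDominationNumber-∨ˡ : IndepDominationNumber G a → (∀ S → IsMaximalIndependent H S → a ≤ ∣ S ∣) →
                             IndepDominationNumber (G ∨G H) a
  indepDominationNumber-∨ˡ ((S , mis , ∣S∣≡a) , minimal) minimalH =
    (S ++ ⊥ {suc n} , ∨-mis⁺ˡ {G = G} {H = H} mis (mis-nonempty {G = G} mis) ,
     trans (∣p++⊥∣≡∣p∣ {n = suc n} S) ∣S∣≡a) ,
    ∨-mis-≥ minimal minimalH

  indepDominationNumber-∨ʳ : (∀ S → IsMaximalIndependent G S → a ≤ ∣ S ∣) → IndepDominationNumber H a →
                             IndepDominationNumber (G ∨G H) a
  indepDominationNumber-∨ʳ minimalG ((S , mis , ∣S∣≡a) , minimal) =
    (⊥ {suc m} ++ S , ∨-mis⁺ʳ {G = G} {H = H} mis (mis-nonempty {G = H} mis) ,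
     trans (∣⊥++p∣≡∣p∣ {suc m} S) ∣S∣≡a) ,
    ∨-mis-≥ minimalG minimal

indepDominationNumber-∨ : ∀ {m n} {G : Graph (suc m)} {H : Graph (suc n)} {a b} →
  IndepDominationNumber G a → IndepDominationNumber H b → IndepDominationNumber (G ∨G H) (a ⊓ b)
indepDominationNumber-∨ {G = G} {H} {a} {b} iG@(_ , minimalG) iH@(_ , minimalH) with ≤-total a b
... | inj₁ a≤b = subst (IndepDominationNumber (G ∨G H)) (≡.sym (m≤n⇒m⊓n≡m a≤b))
                   (indepDominationNumber-∨ˡ {G = G} {H = H} iG (λ S mis → ≤-trans a≤b (minimalH S mis)))
... | inj₂ b≤a = subst (IndepDominationNumber (G ∨G H)) (≡.sym (m≥n⇒m⊓n≡n b≤a))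
                   (indepDominationNumber-∨ʳ {G = G} {H = H} (λ S mis → ≤-trans b≤a (minimalG S mis)) iH)

grundyPackingNumber-∨ : ∀ {m n} (G : Graph (suc m)) (H : Graph (suc n)) {a b} →
  IndepDominationNumber G a → IndepDominationNumber H b →
  GrundyPackingNumber (G ∨G H) (suc m + suc n ∸ (a ⊓ b) + 1)
grundyPackingNumber-∨ G H iG iH =
  grundyPackingNumber-diameter≤2 (∨-diameter≤2 G H) (indepDominationNumber-∨ {G = G} {H = H} iG iH)

-- Complete and edgeless graphs

indepDominationNumber-Kbar : ∀ n → IndepDominationNumber (Kbar n) n
indepDominationNumber-Kbar n =
  (⊤ , ((λ _ _ _ _ → refl) , λ v v∉⊤ → contradiction ∈⊤ v∉⊤) , ∣⊤∣≡n n) ,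
  λ S mis → subst (_≤ ∣ S ∣) (∣⊤∣≡n n) (p⊆q⇒∣p∣≤∣q∣ {p = ⊤} (λ {v} _ → every-vertex-∈ S mis v))
  where
  every-vertex-∈ : ∀ S → IsMaximalIndependent (Kbar n) S → ∀ v → v ∈ S
  every-vertex-∈ S (_ , dominating) v with v ∈? S
  ... | yes v∈S = v∈S
  ... | no  v∉S with () ← proj₂ (proj₂ (dominating v v∉S))

K-adj : ∀ {n} {u v : Fin n} → u ≢ v → adj (K n) u v ≡ true
K-adj {u = u} {v} u≢v = cong not (trans (isYes≗does (u ≟ v)) (dec-false (u ≟ v) u≢v))

indepDominationNumber-K : ∀ n → IndepDominationNumber (K (suc n)) 1
indepDominationNumber-K n =
  (⁅ zero ⁆ , (independent , dominating) , ∣⁅x⁆∣≡1 {suc n} zero) , λ S → 1≤∣mis∣ {G = K (suc n)} {S = S}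
  where
  independent : IsIndependent (K (suc n)) ⁅ zero ⁆
  independent u v u∈ v∈ rewrite x∈⁅y⁆⇒x≡y zero u∈ | x∈⁅y⁆⇒x≡y zero v∈ = irrefl (K (suc n)) zero
  dominating : IsDominating (K (suc n)) ⁅ zero ⁆
  dominating v v∉ = zero , x∈⁅x⁆ zero , K-adj (x∉⁅y⁆⇒x≢y v∉ ∘ ≡.sym)

-- Paths and cycles

Consecutive : ℕ → ℕ → Set
Consecutive i j = suc i ≡ j ⊎ suc j ≡ i

∣i-j∣≡1⇒consecutive : ∀ i j → ∣ i - j ∣ ≡ 1 → Consecutive i j
∣i-j∣≡1⇒consecutive zero          (suc zero) _  = inj₁ refl
∣i-j∣≡1⇒consecutive (suc zero)    zero       _  = inj₂ refl
∣i-j∣≡1⇒consecutive (suc i)       (suc j)    eq = map (cong suc) (cong suc) (∣i-j∣≡1⇒consecutive i j eq)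
∣i-j∣≡1⇒consecutive zero          zero          ()
∣i-j∣≡1⇒consecutive zero          (suc (suc j)) ()
∣i-j∣≡1⇒consecutive (suc (suc i)) zero          ()

∣i-1+i∣≡1 : ∀ i → ∣ i - suc i ∣ ≡ 1
∣i-1+i∣≡1 zero    = refl
∣i-1+i∣≡1 (suc i) = ∣i-1+i∣≡1 i

consecutive⇒∣i-j∣≡1 : ∀ {i j} → Consecutive i j → ∣ i - j ∣ ≡ 1
consecutive⇒∣i-j∣≡1 {i}     (inj₁ refl) = ∣i-1+i∣≡1 i
consecutive⇒∣i-j∣≡1 {j = j} (inj₂ refl) = trans (∣-∣-comm (suc j) j) (∣i-1+i∣≡1 j)

∣i-j∣≡o⇒extremes : ∀ {i j o} → i ≤ o → j ≤ o → ∣ i - j ∣ ≡ o → (i ≡ 0 × j ≡ o) ⊎ (j ≡ 0 × i ≡ o)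
∣i-j∣≡o⇒extremes {zero}          _   _   eq = inj₁ (refl , eq)
∣i-j∣≡o⇒extremes {suc i} {zero}  _   _   eq = inj₂ (refl , eq)
∣i-j∣≡o⇒extremes {suc i} {suc j} i<o j<o eq =
  contradiction (≤-trans (s≤s (∣m-n∣≤m⊔n i j)) (⊔-lub i<o j<o)) (ℕₚ.<-irrefl eq)

P-adj⇒ : ∀ {p} {u v : Fin p} → adj (P p) u v ≡ true → Consecutive (toℕ u) (toℕ v)
P-adj⇒ uv = ∣i-j∣≡1⇒consecutive _ _ (≡ᵇ⇒≡ _ 1 (Equivalence.from T-≡ uv))

P-adj⇐ : ∀ {p} {u v : Fin p} → Consecutive (toℕ u) (toℕ v) → adj (P p) u v ≡ true
P-adj⇐ cons = cong (_≡ᵇ 1) (consecutive⇒∣i-j∣≡1 cons)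

P⊆C : ∀ {p} {u v : Fin p} → adj (P p) u v ≡ true → adj (C p) u v ≡ true
P⊆C uv rewrite uv = refl

P⊆C-dominating : ∀ {p} {S : Subset p} → IsDominating (P p) S → IsDominating (C p) S
P⊆C-dominating {p} dominating v v∉ = let u , u∈S , uv = dominating v v∉ in u , u∈S , P⊆C {p} {u} {v} uv

C-adj⇒ : ∀ {q} {u v : Fin (suc q)} → adj (C (suc q)) u v ≡ true →
         Consecutive (toℕ u) (toℕ v) ⊎ (toℕ u ≡ 0 × toℕ v ≡ q) ⊎ (toℕ v ≡ 0 × toℕ u ≡ q)
C-adj⇒ {q} {u} {v} uv with Equivalence.to T-∨ (Equivalence.from T-≡ uv)
... | inj₁ d≡1  = inj₁ (∣i-j∣≡1⇒consecutive _ _ (≡ᵇ⇒≡ _ 1 d≡1))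
... | inj₂ wrap = inj₂ (∣i-j∣≡o⇒extremes (Finₚ.toℕ≤pred[n] u) (Finₚ.toℕ≤pred[n] v)
                          (≡ᵇ⇒≡ _ q (proj₂ (Equivalence.to T-∧ wrap))))

C-adj⇒cyclic : ∀ {q} {u v : Fin (suc q)} → adj (C (suc q)) u v ≡ true → u ≡ cyclicPred v ⊎ u ≡ cyclicSuc v
C-adj⇒cyclic {q} {u} {v} uv with C-adj⇒ uv
... | inj₁ (inj₁ 1+u≡v)        = inj₁ (Finₚ.toℕ-injective (≡.sym (toℕ-cyclicPred (≡.sym 1+u≡v))))
... | inj₁ (inj₂ 1+v≡u)        = inj₂ (Finₚ.toℕ-injective (trans (≡.sym 1+v≡u) (≡.sym (toℕ-cyclicSuc v<q))))
  where v<q = subst (_≤ q) (≡.sym 1+v≡u) (Finₚ.toℕ≤pred[n] u)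
... | inj₂ (inj₁ (u≡0 , v≡q)) =
  inj₂ (Finₚ.toℕ-injective (trans u≡0 (cong toℕ (≡.sym (cyclicSuc-last v≡q)))))
... | inj₂ (inj₂ (v≡0 , u≡q)) rewrite Finₚ.toℕ-injective {j = zero} v≡0 =
  inj₁ (Finₚ.toℕ-injective (trans u≡q (≡.sym toℕ-cyclicPred-zero)))

C-dominating⇒ : ∀ {q} {S : Subset (suc q)} → IsDominating (C (suc q)) S → suc q ≤ 3 * ∣ S ∣
C-dominating⇒ {q} {S} dominating = begin
  suc q                                    ≤⟨ n≤sum closedNbhd covered ⟩
  sum closedNbhd                           ≡⟨ ∑-distrib-+ (λ v → χ (cyclicPred v) + χ v) (χ ∘ cyclicSuc) ⟩
  sum (λ v → χ (cyclicPred v) + χ v) + sum (χ ∘ cyclicSuc)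
    ≡⟨ cong (_+ sum (χ ∘ cyclicSuc)) (∑-distrib-+ (χ ∘ cyclicPred) χ) ⟩
  sum (χ ∘ cyclicPred) + sum χ + sum (χ ∘ cyclicSuc)
    ≡⟨ cong₂ (λ x y → x + sum χ + y) (∑-cyclicPred χ) (∑-cyclicSuc χ) ⟩
  sum χ + sum χ + sum χ                    ≡⟨ cong (λ x → x + x + x) (≡.sym (∣p∣≡∑indicator S)) ⟩
  ∣ S ∣ + ∣ S ∣ + ∣ S ∣                    ≡⟨ x+x+x≡3*x ∣ S ∣ ⟩
  3 * ∣ S ∣                                ∎
  where
  open ≤-Reasoning
  χ = indicator S
  closedNbhd : Fin (suc q) → ℕ
  closedNbhd v = χ (cyclicPred v) + χ v + χ (cyclicSuc v)
  x+x+x≡3*x : ∀ x → x + x + x ≡ 3 * x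
  x+x+x≡3*x x = trans (+-assoc x x x) (cong (λ y → x + (x + y)) (≡.sym (+-identityʳ x)))
  1≤χ : ∀ {x} → x ∈ S → 1 ≤ χ x
  1≤χ x∈S = ≤-reflexive (≡.sym (indicator-∈ x∈S))
  covered : ∀ v → 1 ≤ closedNbhd v
  covered v with v ∈? S
  ... | yes v∈S = ≤-trans (1≤χ v∈S) (≤-trans (m≤n+m (χ v) (χ (cyclicPred v))) (m≤m+n _ (χ (cyclicSuc v))))
  ... | no  v∉S with dominating v v∉S
  ...   | u , u∈S , uv with C-adj⇒cyclic {u = u} {v} uv
  ...     | inj₁ refl = ≤-trans (1≤χ u∈S) (≤-trans (m≤m+n _ _) (m≤m+n _ _))
  ...     | inj₂ refl = ≤-trans (1≤χ u∈S) (m≤n+m _ _)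

ceil3-+3 : ∀ p → ceil3 (3 + p) ≡ suc (ceil3 p)
ceil3-+3 p = m/n≡1+[m∸n]/n {3 + p + 2} {3} (s≤s (s≤s (s≤s z≤n)))

ceil3-≤ : ∀ {p c} → p ≤ 3 * c → ceil3 p ≤ c
ceil3-≤ {p} {c} p≤3c = ℕₚ.≤-pred (m<n*o⇒m/o<n (begin-strict
  p + 2       <⟨ +-monoʳ-< p (n<1+n 2) ⟩
  p + 3       ≡⟨ +-comm p 3 ⟩
  3 + p       ≤⟨ +-monoʳ-≤ 3 (subst (p ≤_) (*-comm 3 c) p≤3c) ⟩
  3 + c * 3   ∎))
  where open ≤-Reasoning

-- Vertex j of P_p is a centre iff j ≡ 1 (mod 3), or j = p - 1 ≡ 0 (mod 3).
isCentre : ℕ → ℕ → Bool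
isCentre 1                   0                   = true
isCentre 2                   1                   = true
isCentre (suc (suc (suc p))) 1                   = true
isCentre (suc (suc (suc p))) (suc (suc (suc j))) = isCentre p j
isCentre _                   _                   = false

isCentre-< : ∀ p j → isCentre p j ≡ true → j < p
isCentre-< 1                   0                   _ = s≤s z≤n
isCentre-< 2                   1                   _ = s≤s (s≤s z≤n)
isCentre-< (suc (suc (suc p))) 1                   _ = s≤s (s≤s z≤n)
isCentre-< (suc (suc (suc p))) (suc (suc (suc j))) c = s≤s (s≤s (s≤s (isCentre-< p j c)))
isCentre-< 0                   _                   ()
isCentre-< 1                   (suc _)             ()
isCentre-< 2                   0                   ()
isCentre-< 2                   (suc (suc _))       ()
isCentre-< (suc (suc (suc p))) 0                   ()
isCentre-< (suc (suc (suc p))) 2                   ()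

isCentre-suc : ∀ p j → isCentre p j ≡ true → isCentre p (suc j) ≡ false
isCentre-suc 1                   0                   _ = refl
isCentre-suc 2                   1                   _ = refl
isCentre-suc (suc (suc (suc p))) 1                   _ = refl
isCentre-suc (suc (suc (suc p))) (suc (suc (suc j))) c = isCentre-suc p j c
isCentre-suc 0                   _                   ()
isCentre-suc 1                   (suc _)             ()
isCentre-suc 2                   0                   ()
isCentre-suc 2                   (suc (suc _))       ()
isCentre-suc (suc (suc (suc p))) 0                   ()
isCentre-suc (suc (suc (suc p))) 2                   ()

isCentre-dominated : ∀ p j → j < p → isCentre p j ≡ false →
                     isCentre p (suc j) ≡ true ⊎ ∃ λ i → suc i ≡ j × isCentre p i ≡ true
isCentre-dominated 2                   0                   _ _ = inj₁ refl
isCentre-dominated (suc (suc (suc p))) 0                   _ _ = inj₁ refl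
isCentre-dominated (suc (suc (suc p))) 2                   _ _ = inj₂ (1 , refl , refl)
isCentre-dominated (suc (suc (suc p))) (suc (suc (suc j))) (s≤s (s≤s (s≤s j<p))) c =
  map₂ (λ (i , 1+i≡j , centre) → 3 + i , cong (3 +_) 1+i≡j , centre) (isCentre-dominated p j j<p c)
isCentre-dominated 1                   0                   _ ()
isCentre-dominated 1                   (suc _)             (s≤s ())
isCentre-dominated 2                   1                   _ ()
isCentre-dominated 2                   (suc (suc _))       (s≤s (s≤s ()))
isCentre-dominated (suc (suc (suc p))) 1                   _ ()

centres : (p : ℕ) → Subset p
centres p = tabulate (isCentre p ∘ toℕ)

∣centres∣ : ∀ p → ∣ centres p ∣ ≡ ceil3 p
∣centres∣ 0                   = refl
∣centres∣ 1                   = refl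
∣centres∣ 2                   = refl
∣centres∣ (suc (suc (suc p))) = trans (cong suc (∣centres∣ p)) (≡.sym (ceil3-+3 p))

module _ {p : ℕ} where

  ∈-centres⁺ : ∀ {v : Fin p} → isCentre p (toℕ v) ≡ true → v ∈ centres p
  ∈-centres⁺ = ∈-tabulate⁺

  ∈-centres⁻ : ∀ {v : Fin p} → v ∈ centres p → isCentre p (toℕ v) ≡ true
  ∈-centres⁻ = ∈-tabulate⁻ {f = isCentre p ∘ toℕ}

  ∉-centres : ∀ {v : Fin p} → v ∉ centres p → isCentre p (toℕ v) ≡ false
  ∉-centres v∉ = ¬-not (v∉ ∘ ∈-centres⁺)

  centreAt : ∀ {j} → isCentre p j ≡ true → ∃ λ (u : Fin p) → toℕ u ≡ j × u ∈ centres p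
  centreAt {j} c = fromℕ< j<p , Finₚ.toℕ-fromℕ< j<p ,
                   ∈-centres⁺ (trans (cong (isCentre p) (Finₚ.toℕ-fromℕ< j<p)) c)
    where j<p = isCentre-< p j c

  centres-not-consecutive : ∀ {u v : Fin p} → u ∈ centres p → v ∈ centres p → ¬ Consecutive (toℕ u) (toℕ v)
  centres-not-consecutive u∈ v∈ (inj₁ 1+u≡v) =
    case trans (≡.sym (∈-centres⁻ v∈)) v-not-centre of λ ()
    where
    v-not-centre = subst (λ j → isCentre p j ≡ false) 1+u≡v (isCentre-suc p _ (∈-centres⁻ u∈))
  centres-not-consecutive u∈ v∈ (inj₂ 1+v≡u) =
    centres-not-consecutive v∈ u∈ (inj₁ 1+v≡u)

  centres-dominating-P : IsDominating (P p) (centres p)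
  centres-dominating-P v v∉ with isCentre-dominated p (toℕ v) (Finₚ.toℕ<n v) (∉-centres v∉)
  ... | inj₁ next =
    let u , u≡1+v , u∈ = centreAt next in u , u∈ , P-adj⇐ (inj₂ (≡.sym u≡1+v))
  ... | inj₂ (i , 1+i≡v , previous) =
    let u , u≡i , u∈ = centreAt previous in u , u∈ , P-adj⇐ (inj₁ (trans (cong suc u≡i) 1+i≡v))

  centres-mis-P : IsMaximalIndependent (P p) (centres p)
  centres-mis-P = (λ u v u∈ v∈ → ¬-not (centres-not-consecutive u∈ v∈ ∘ P-adj⇒)) , centres-dominating-P

centres-mis-C : ∀ n → IsMaximalIndependent (C (3 + n)) (centres (3 + n))
centres-mis-C n = independent , P⊆C-dominating centres-dominating-P
  where
  0∉centres : ∀ {u : Fin (3 + n)} → u ∈ centres (3 + n) → toℕ u ≢ 0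
  0∉centres u∈ u≡0 = case trans (≡.sym (∈-centres⁻ u∈)) (cong (isCentre (3 + n)) u≡0) of λ ()
  independent : IsIndependent (C (3 + n)) (centres (3 + n))
  independent u v u∈ v∈ = ¬-not λ uv → case C-adj⇒ uv of λ where
    (inj₁ consecutive)       → centres-not-consecutive {u = u} {v} u∈ v∈ consecutive
    (inj₂ (inj₁ (u≡0 , _))) → 0∉centres {u} u∈ u≡0
    (inj₂ (inj₂ (v≡0 , _))) → 0∉centres {v} v∈ v≡0

indepDominationNumber-P : ∀ p → IndepDominationNumber (P p) (ceil3 p)
indepDominationNumber-P p = (centres p , centres-mis-P , ∣centres∣ p) , λ S mis → ceil3-≤ (bound p (proj₂ mis))
  where
  bound : ∀ p {S} → IsDominating (P p) S → p ≤ 3 * ∣ S ∣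
  bound zero    _          = z≤n
  bound (suc q) dominating = C-dominating⇒ (P⊆C-dominating dominating)

indepDominationNumber-C : ∀ n → IndepDominationNumber (C (3 + n)) (ceil3 (3 + n))
indepDominationNumber-C n =
  (centres (3 + n) , centres-mis-C n , ∣centres∣ (3 + n)) , λ S mis → ceil3-≤ (C-dominating⇒ (proj₂ mis))

corollary12 :
    (∀ {m n} (G : Graph (suc m)) (H : Graph (suc n)) (a b : ℕ) →
        IndepDominationNumber G a → IndepDominationNumber H b →
        GrundyPackingNumber (G ∨G H) (suc m + suc n ∸ (a ⊓ b) + 1))
    ×
    (∀ s t → 1 ≤ s → 1 ≤ t →
        GrundyPackingNumber (Kbip s t) (s + t ∸ (s ⊓ t) + 1))
    ×
    (∀ {m} (G : Graph (suc m)) →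
        GrundyPackingNumber (G ∨G K 1) (suc m + 1))
    ×
    (∀ s n → 1 ≤ s → 2 ≤ n →
        GrundyPackingNumber (K s ∨G Kbar n) (s + n))
    ×
    (∀ p r → 4 ≤ p → 4 ≤ r →
        GrundyPackingNumber (P p ∨G P r) (p + r ∸ (ceil3 p ⊓ ceil3 r) + 1)
        × GrundyPackingNumber (P p ∨G C r) (p + r ∸ (ceil3 p ⊓ ceil3 r) + 1)
        × GrundyPackingNumber (C p ∨G C r) (p + r ∸ (ceil3 p ⊓ ceil3 r) + 1))
corollary12 = (λ G H _ _ → grundyPackingNumber-∨ G H) , bipartite , apex , complete∨edgeless , pathsCycles
  where
  bipartite : ∀ s t → 1 ≤ s → 1 ≤ t → GrundyPackingNumber (Kbip s t) (s + t ∸ (s ⊓ t) + 1)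
  bipartite (suc s) (suc t) _ _ =
    grundyPackingNumber-∨ (Kbar _) (Kbar _) (indepDominationNumber-Kbar _) (indepDominationNumber-Kbar _)

  apex : ∀ {m} (G : Graph (suc m)) → GrundyPackingNumber (G ∨G K 1) (suc m + 1)
  apex {m} G = subst (GrundyPackingNumber (G ∨G K 1)) (+-comm (m + 1) 1)
    (grundyPackingNumber-diameter≤2 (∨-diameter≤2 G (K 1))
      (indepDominationNumber-∨ʳ {G = G} {H = K 1} (λ S → 1≤∣mis∣ {G = G} {S = S}) (indepDominationNumber-K 0)))

  complete∨edgeless : ∀ s n → 1 ≤ s → 2 ≤ n → GrundyPackingNumber (K s ∨G Kbar n) (s + n)
  complete∨edgeless (suc s) (suc n) _ _ =
    subst (GrundyPackingNumber (K (suc s) ∨G Kbar (suc n))) (+-comm (s + suc n) 1)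
    (grundyPackingNumber-∨ (K _) (Kbar _) (indepDominationNumber-K s) (indepDominationNumber-Kbar (suc n)))

  pathsCycles : ∀ p r → 4 ≤ p → 4 ≤ r →
    GrundyPackingNumber (P p ∨G P r) (p + r ∸ (ceil3 p ⊓ ceil3 r) + 1)
    × GrundyPackingNumber (P p ∨G C r) (p + r ∸ (ceil3 p ⊓ ceil3 r) + 1)
    × GrundyPackingNumber (C p ∨G C r) (p + r ∸ (ceil3 p ⊓ ceil3 r) + 1)
  pathsCycles (suc (suc (suc p))) (suc (suc (suc r))) (s≤s (s≤s (s≤s _))) (s≤s (s≤s (s≤s _))) =
    grundyPackingNumber-∨ (P _) (P _) (indepDominationNumber-P _) (indepDominationNumber-P _) ,
    grundyPackingNumber-∨ (P _) (C _) (indepDominationNumber-P _) (indepDominationNumber-C r) ,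
    grundyPackingNumber-∨ (C _) (C _) (indepDominationNumber-C p) (indepDominationNumber-C r)
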